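{- Let $b\ge 3$ be odd and $k\ge 2$. Then the number $$N_k=[(b-1)^{\land (2^{k-1}-1)}(b-2)(0)^{\land (2^{k-1}-1)}1]_b$$ is a $b$-MRH number, $N_k$ is a perfect square, and $s_b(\sqrt{N_k})=s_b(N_k)$. Moreover, if $b\equiv 3\pmod 4$, then $\sqrt{N_k}$ is a $b$-Niven number.
   Context: For a digit string $x$, $(x)^{\land m}$ denotes $x$ concatenated $m$ times, and $[x]_b$ denotes the integer whose base-$b$ representation is the string $x$ (here $b-1$ and $b-2$ denote single base-$b$ digits). For a positive integer $N$, $s_b(N)$ is the sum of the base-$b$ digits of $N$, and the reversal $N^R$ is the integer obtained by writing the base-$b$ digits of $N$ in reverse order. A positive integer $N$ is a $b$-MRH number if there exists a positive integer $M$ such that $N=Ms_b(N)\cdot(Ms_b(N))^R$. A positive integer $N$ is a $b$-Niven number if $s_b(N)$ divides $N$. -}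

module Defs where

open import Data.Nat using (ℕ; zero; suc; _+_; _*_; _∸_; _^_; _<_; NonZero)
open import Data.Nat.DivMod using (_/_; _%_)
open import Data.Nat.Divisibility using (_∣_)
open import Data.List using (List; []; _∷_; _++_; replicate; foldl; reverse)
open import Data.Nat.ListAction using (sum)
open import Data.Product using (Σ; _×_)
open import Relation.Binary.PropositionalEquality using (_≡_)

-- [x]_b : value of a digit string (most significant digit first) in base b
fromDigits : ℕ → List ℕ → ℕ
fromDigits b = foldl (λ acc d → acc * b + d) 0

-- base-b digits of n, least significant first (no leading zeros; [] for n = 0).
-- The fuel argument bounds the number of digits; fuel n suffices when b ≥ 2.
digitsLEFuel : ℕ → (b : ℕ) → .{{NonZero b}} → ℕ → List ℕ
digitsLEFuel zero b n = []
digitsLEFuel (suc f) b zero = []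
digitsLEFuel (suc f) b n@(suc _) = (n % b) ∷ digitsLEFuel f b (n / b)

digitsLE : (b : ℕ) → .{{NonZero b}} → ℕ → List ℕ
digitsLE b n = digitsLEFuel n b n

digitSum : (b : ℕ) → .{{NonZero b}} → ℕ → ℕ
digitSum b n = sum (digitsLE b n)

-- N^R : reversal of the base-b digits of N
rev : (b : ℕ) → .{{NonZero b}} → ℕ → ℕ
rev b n = fromDigits b (digitsLE b n)

IsMRH : (b : ℕ) → .{{NonZero b}} → ℕ → Set
IsMRH b N = Σ ℕ λ M → (0 < M) × (N ≡ (M * digitSum b N) * rev b (M * digitSum b N))

IsNiven : (b : ℕ) → .{{NonZero b}} → ℕ → Set
IsNiven b N = digitSum b N ∣ N

Nk : ℕ → ℕ → ℕ
Nk b k = fromDigits b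
  (replicate (2 ^ (k ∸ 1) ∸ 1) (b ∸ 1) ++ (b ∸ 2) ∷ replicate (2 ^ (k ∸ 1) ∸ 1) 0 ++ 1 ∷ [])

module Submission where

-- Write q = b - 1 and p = b - 2, let R j = [1^j]_b be the base-b repunit of
-- length j, and put n = 2^(k-1) - 1, m = n + 1 = 2^(k-1).
--  * The leading block [q^n p]_b equals A = q·R m - 1 and b^m = q·R m + 1, so
--    N_k = A·b^m + 1 = (q·R m)^2: N_k is the square of the repdigit
--    r = q·R m = [q^m]_b, which is a base-b palindrome.
--  * Reading off base-b digits gives s_b(N_k) = 1 + p + n·q = m·q = s_b(r).
--  * For odd b, R(2j) = R j · (b^j + 1) with b^j + 1 even, so 2^t ∣ R(2^t);
--    hence m ∣ R m, say R m = M·m with M > 0.  Then M·s_b(N_k) = q·R m = r,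
--    and N_k = r·r^R is MRH; moreover s_b(r) = m·q divides q·R m = r, so r is
--    Niven (for every odd b, in particular for b ≡ 3 mod 4).

open import Defs
open import Data.Nat using (ℕ; zero; suc; _+_; _*_; _∸_; _^_; _≤_; _<_; z≤n; s≤s; NonZero)
open import Data.Nat.Base using (>-nonZero; >-nonZero⁻¹)
open import Data.Nat.Properties
  using (≤-refl; ≤-trans; ≤-pred; <-trans; +-comm; +-identityʳ; *-identityʳ; *-comm; *-mono-<;
         m≤m+n; m≤n+m; m^n>0; m+[n∸m]≡n)
open import Data.Nat.DivMod
  using (_/_; _%_; m≡m%n+[m/n]*n; [m+kn]%n≡m%n; m<n⇒m%n≡m; m<n⇒m/n≡0; m*n/n≡m; m/n<m;
         +-distrib-/-∣ʳ)
open import Data.Nat.Divisibility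
  using (_∣_; divides; quotient; quotient≢0; m∣n⇒n≡quotient*m; n∣m*n; ∣m∣n⇒∣m+n; *-pres-∣;
         *-monoʳ-∣)
open import Data.List using (List; []; _∷_; _++_; replicate; foldl)
open import Data.List.Properties using (foldl-++)
open import Data.Nat.ListAction using (sum)
open import Data.Nat.ListAction.Properties using (sum-++)
open import Data.Product using (Σ; _×_; _,_)
open import Relation.Binary.PropositionalEquality
  using (_≡_; refl; sym; trans; cong; cong₂; subst; subst₂; module ≡-Reasoning)
open import Data.Nat.Tactic.RingSolver using (solve-∀)

open ≡-Reasoning

sum-replicate : ∀ j d → sum (replicate j d) ≡ j * d
sum-replicate zero    d = refl
sum-replicate (suc j) d = cong (d +_) (sum-replicate j d)

repunit : ℕ → ℕ → ℕ
repunit b zero    = 0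
repunit b (suc j) = repunit b j * b + 1

module Repunit (b : ℕ) where

  R : ℕ → ℕ
  R = repunit b

  horner : ℕ → ℕ → ℕ
  horner acc d = acc * b + d

  -- R (j + 1) computed from either end: b^j + R j = R j · b + 1.
  power+repunit : ∀ j → b ^ j + R j ≡ R j * b + 1
  power+repunit zero    = refl
  power+repunit (suc j) = begin
    b * b ^ j + (R j * b + 1)  ≡⟨ regroup (b ^ j) (R j) b ⟩
    b * (b ^ j + R j) + 1      ≡⟨ cong (λ x → b * x + 1) (power+repunit j) ⟩
    b * (R j * b + 1) + 1      ≡⟨ cong (_+ 1) (*-comm b (R j * b + 1)) ⟩
    (R j * b + 1) * b + 1      ∎
    where
    regroup : ∀ x y b → b * x + (y * b + 1) ≡ b * (x + y) + 1
    regroup = solve-∀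

  horner-replicate : ∀ j a d → foldl horner a (replicate j d) ≡ a * b ^ j + d * R j
  horner-replicate zero    a d = solve-zero a d
    where
    solve-zero : ∀ a d → a ≡ a * 1 + d * 0
    solve-zero = solve-∀
  horner-replicate (suc j) a d = begin
    foldl horner (a * b + d) (replicate j d)  ≡⟨ horner-replicate j (a * b + d) d ⟩
    (a * b + d) * b ^ j + d * R j             ≡⟨ regroup a b d (b ^ j) (R j) ⟩
    a * (b * b ^ j) + d * (b ^ j + R j)       ≡⟨ cong (λ x → a * (b * b ^ j) + d * x) (power+repunit j) ⟩
    a * (b * b ^ j) + d * (R j * b + 1)       ∎
    where
    regroup : ∀ a b d x y → (a * b + d) * x + d * y ≡ a * (b * x) + d * (x + y)
    regroup = solve-∀

  repunit-+ : ∀ i j → R (i + j) ≡ R i * b ^ j + R j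
  repunit-+ i zero    = trans (cong R (+-identityʳ i)) (solve-zero (R i))
    where
    solve-zero : ∀ x → x ≡ x * 1 + 0
    solve-zero = solve-∀
  repunit-+ i (suc j) = begin
    R (i + suc j)                     ≡⟨ cong R (+-comm i (suc j)) ⟩
    R (j + i) * b + 1                 ≡⟨ cong (λ x → R x * b + 1) (+-comm j i) ⟩
    R (i + j) * b + 1                 ≡⟨ cong (λ x → x * b + 1) (repunit-+ i j) ⟩
    (R i * b ^ j + R j) * b + 1       ≡⟨ regroup (R i) (b ^ j) (R j) b ⟩
    R i * (b * b ^ j) + (R j * b + 1) ∎
    where
    regroup : ∀ x y z b → (x * y + z) * b + 1 ≡ x * (b * y) + (z * b + 1)
    regroup = solve-∀

  repunit-double : ∀ j → R (j + j) ≡ R j * (b ^ j + 1)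
  repunit-double j = trans (repunit-+ j j) (factor (R j) (b ^ j))
    where
    factor : ∀ x y → x * y + x ≡ x * (y + 1)
    factor = solve-∀

  -- Nonempty repunits are positive (so their divisors have nonzero quotients).
  repunit-positive : ∀ j → 0 < R (suc j)
  repunit-positive j = m≤n+m 1 (R j * b)

power≡repunit : ∀ q j → suc q ^ j ≡ q * repunit (suc q) j + 1
power≡repunit q zero    = cong (_+ 1) (sym (*-comm q 0))
power≡repunit q (suc j) = begin
  suc q * suc q ^ j                   ≡⟨ cong (suc q *_) (power≡repunit q j) ⟩
  suc q * (q * repunit (suc q) j + 1) ≡⟨ regroup q (repunit (suc q) j) ⟩
  q * (repunit (suc q) j * suc q + 1) + 1 ∎
  where
  regroup : ∀ q x → suc q * (q * x + 1) ≡ q * (x * suc q + 1) + 1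
  regroup = solve-∀

module OddBase {b : ℕ} (b-odd : b % 2 ≡ 1) where
  open Repunit b

  -- b^j + 1 is even: b^(j+1) + 1 = (b^j + 1) + 2·⌊b/2⌋·b^j.
  power+1-even : ∀ j → 2 ∣ b ^ j + 1
  power+1-even zero    = divides 1 refl
  power+1-even (suc j) =
    subst (2 ∣_) (sym split) (∣m∣n⇒∣m+n (power+1-even j) (n∣m*n (b / 2 * b ^ j)))
    where
    b≡1+2h : b ≡ 1 + b / 2 * 2
    b≡1+2h = trans (m≡m%n+[m/n]*n b 2) (cong (_+ b / 2 * 2) b-odd)
    regroup : ∀ h x → (1 + h * 2) * x + 1 ≡ (x + 1) + h * x * 2
    regroup = solve-∀
    split : b * b ^ j + 1 ≡ (b ^ j + 1) + b / 2 * b ^ j * 2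
    split = trans (cong (λ x → x * b ^ j + 1) b≡1+2h) (regroup (b / 2) (b ^ j))

  -- 2^t divides the repunit of length 2^t, by doubling t times.
  power-of-two-divides-repunit : ∀ t → 2 ^ t ∣ R (2 ^ t)
  power-of-two-divides-repunit zero    = divides 1 refl
  power-of-two-divides-repunit (suc t) =
    subst₂ _∣_ (*-comm (2 ^ t) 2) (sym R-double)
      (*-pres-∣ (power-of-two-divides-repunit t) (power+1-even (2 ^ t)))
    where
    R-double : R (2 ^ suc t) ≡ R (2 ^ t) * (b ^ (2 ^ t) + 1)
    R-double = trans (cong (λ x → R (2 ^ t + x)) (+-identityʳ (2 ^ t))) (repunit-double (2 ^ t))

module Digits (b : ℕ) .{{_ : NonZero b}} (1<b : 1 < b) where
  open Repunit b

  digitsLEFuel-zero : ∀ f → digitsLEFuel f b 0 ≡ []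
  digitsLEFuel-zero zero    = refl
  digitsLEFuel-zero (suc f) = refl

  digitsLEFuel-irrelevant : ∀ f g x → x ≤ f → x ≤ g → digitsLEFuel f b x ≡ digitsLEFuel g b x
  digitsLEFuel-irrelevant f g zero _ _ = trans (digitsLEFuel-zero f) (sym (digitsLEFuel-zero g))
  digitsLEFuel-irrelevant zero g (suc x) () _
  digitsLEFuel-irrelevant (suc f) zero (suc x) _ ()
  digitsLEFuel-irrelevant (suc f) (suc g) x@(suc _) x≤f x≤g =
    cong (x % b ∷_) (digitsLEFuel-irrelevant f g (x / b) (shrink x≤f) (shrink x≤g))
    where
    shrink : ∀ {h} → x ≤ suc h → x / b ≤ h
    shrink x≤h = ≤-pred (≤-trans (m/n<m x b 1<b) x≤h)

  digits-cons : ∀ {x y d} → x ≡ d + y * b → d < b → 0 < x → digitsLE b x ≡ d ∷ digitsLE b y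
  digits-cons {suc x-1} {y} {d} x≡ d<b _ =
    cong₂ _∷_ last-digit
      (trans (cong (digitsLEFuel x-1 b) rest) (digitsLEFuel-irrelevant x-1 y y y≤x-1 ≤-refl))
    where
    last-digit : suc x-1 % b ≡ d
    last-digit = begin
      suc x-1 % b    ≡⟨ cong (_% b) x≡ ⟩
      (d + y * b) % b ≡⟨ [m+kn]%n≡m%n d y b ⟩
      d % b          ≡⟨ m<n⇒m%n≡m d<b ⟩
      d              ∎
    rest : suc x-1 / b ≡ y
    rest = begin
      suc x-1 / b         ≡⟨ cong (_/ b) x≡ ⟩
      (d + y * b) / b     ≡⟨ +-distrib-/-∣ʳ d (n∣m*n y) ⟩
      d / b + y * b / b   ≡⟨ cong₂ _+_ (m<n⇒m/n≡0 d<b) (m*n/n≡m y b) ⟩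
      y                   ∎
    y≤x-1 : y ≤ x-1
    y≤x-1 = ≤-pred (subst (_< suc x-1) rest (m/n<m (suc x-1) b 1<b))

  digits-shift : ∀ A j → 0 < A → digitsLE b (A * b ^ j) ≡ replicate j 0 ++ digitsLE b A
  digits-shift A zero    _   = cong (digitsLE b) (*-identityʳ A)
  digits-shift A (suc j) 0<A =
    trans (digits-cons (shift A (b ^ j) b) (<-trans (s≤s z≤n) 1<b) (*-mono-< 0<A (m^n>0 b (suc j))))
          (cong (0 ∷_) (digits-shift A j 0<A))
    where
    shift : ∀ a x b → a * (b * x) ≡ 0 + a * x * b
    shift = solve-∀

  digits-repdigit : ∀ {d} → 0 < d → d < b → ∀ j → digitsLE b (d * R j) ≡ replicate j d
  digits-repdigit {d} 0<d d<b zero    = cong (digitsLE b) (*-comm d 0)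
  digits-repdigit {d} 0<d d<b (suc j) =
    trans (digits-cons split d<b (subst (0 <_) (sym split) (≤-trans 0<d (m≤m+n d _))))
          (cong (d ∷_) (digits-repdigit 0<d d<b j))
    where
    regroup : ∀ d x b → d * (x * b + 1) ≡ d + d * x * b
    regroup = solve-∀
    split : d * R (suc j) ≡ d + d * R j * b
    split = regroup d (R j) b

  digitSum-repdigit : ∀ {d} → 0 < d → d < b → ∀ j → digitSum b (d * R j) ≡ j * d
  digitSum-repdigit 0<d d<b j = trans (cong sum (digits-repdigit 0<d d<b j)) (sum-replicate j _)

  repdigit-palindrome : ∀ {d} → 0 < d → d < b → ∀ j → rev b (d * R j) ≡ d * R j
  repdigit-palindrome {d} 0<d d<b j =
    trans (cong (fromDigits b) (digits-repdigit 0<d d<b j)) (horner-replicate j 0 d)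

palindrome-square-MRH : ∀ b .{{_ : NonZero b}} {N r M} →
  0 < M → M * digitSum b N ≡ r → rev b r ≡ r → N ≡ r * r → IsMRH b N
palindrome-square-MRH b {N} {r} {M} 0<M Ms≡r palindrome N≡r² = M , 0<M , (begin
  N                                        ≡⟨ N≡r² ⟩
  r * r                                    ≡⟨ cong (r *_) (sym palindrome) ⟩
  r * rev b r                              ≡⟨ cong (λ x → x * rev b x) (sym Ms≡r) ⟩
  M * digitSum b N * rev b (M * digitSum b N) ∎)

-- The numbers N = [q^n p 0^n 1]_b for b = c + 3, q = b - 1, p = b - 2 and an
-- arbitrary block length n; N_k is the case n = 2^(k-1) - 1.
module Square (c : ℕ) where
  b q p : ℕ
  b = suc (suc (suc c))
  q = suc (suc c)
  p = suc c

  b>1 : 1 < b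
  b>1 = s≤s (s≤s z≤n)
  q>0 : 0 < q
  q>0 = s≤s z≤n
  q<b : q < b
  q<b = ≤-refl
  p<b : p < b
  p<b = s≤s (s≤s (m≤n+m c 1))

  open Repunit b
  open Digits b b>1

  N : ℕ → ℕ
  N n = fromDigits b (replicate n q ++ p ∷ replicate n 0 ++ 1 ∷ [])

  root : ℕ → ℕ
  root n = q * R (suc n)

  lead : ℕ → ℕ
  lead n = q * R n * b + p

  lead+1 : ∀ n → lead n + 1 ≡ root n
  lead+1 n = regroup c (R n)
    where
    regroup : ∀ c x → (suc (suc c) * x) * suc (suc (suc c)) + suc c + 1
                      ≡ suc (suc c) * (x * suc (suc (suc c)) + 1)
    regroup = solve-∀

  lead-positive : ∀ n → 0 < lead n
  lead-positive n = ≤-trans (s≤s z≤n) (m≤n+m p (q * R n * b))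

  N-value : ∀ n → N n ≡ lead n * b ^ n * b + 1
  N-value n = begin
    foldl horner 0 (replicate n q ++ tail)               ≡⟨ foldl-++ horner 0 (replicate n q) tail ⟩
    foldl horner (foldl horner 0 (replicate n q)) tail   ≡⟨ cong (λ x → foldl horner x tail) (horner-replicate n 0 q) ⟩
    foldl horner (lead n) (replicate n 0 ++ 1 ∷ [])      ≡⟨ foldl-++ horner (lead n) (replicate n 0) (1 ∷ []) ⟩
    foldl horner (lead n) (replicate n 0) * b + 1        ≡⟨ cong (λ x → x * b + 1) (horner-replicate n (lead n) 0) ⟩
    (lead n * b ^ n + 0 * R n) * b + 1                   ≡⟨ cong (λ x → x * b + 1) (+-identityʳ (lead n * b ^ n)) ⟩
    lead n * b ^ n * b + 1                               ∎
    where
    tail : List ℕ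
    tail = p ∷ replicate n 0 ++ 1 ∷ []

  -- With r = lead + 1 and b^(n+1) = r + 1, N = (r - 1)(r + 1) + 1 = r².
  N-square : ∀ n → N n ≡ root n * root n
  N-square n = begin
    N n                                  ≡⟨ N-value n ⟩
    lead n * b ^ n * b + 1               ≡⟨ cong (_+ 1) (*-assoc' (lead n) (b ^ n) b) ⟩
    lead n * b ^ suc n + 1               ≡⟨ cong (λ x → lead n * x + 1) (power≡repunit q (suc n)) ⟩
    lead n * (root n + 1) + 1            ≡⟨ cong (λ x → lead n * (x + 1) + 1) (sym (lead+1 n)) ⟩
    lead n * (lead n + 1 + 1) + 1        ≡⟨ complete-square (lead n) ⟩
    (lead n + 1) * (lead n + 1)          ≡⟨ cong₂ _*_ (lead+1 n) (lead+1 n) ⟩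
    root n * root n                      ∎
    where
    *-assoc' : ∀ a x b → a * x * b ≡ a * (b * x)
    *-assoc' = solve-∀
    complete-square : ∀ a → a * (a + 1 + 1) + 1 ≡ (a + 1) * (a + 1)
    complete-square = solve-∀

  N-digits : ∀ n → digitsLE b (N n) ≡ 1 ∷ replicate n 0 ++ p ∷ replicate n q
  N-digits n = begin
    digitsLE b (N n)                                ≡⟨ digits-cons N≡ b>1 N-positive ⟩
    1 ∷ digitsLE b (lead n * b ^ n)                 ≡⟨ cong (1 ∷_) (digits-shift (lead n) n (lead-positive n)) ⟩
    1 ∷ replicate n 0 ++ digitsLE b (lead n)        ≡⟨ cong (λ ds → 1 ∷ replicate n 0 ++ ds) lead-digits ⟩
    1 ∷ replicate n 0 ++ p ∷ digitsLE b (q * R n)   ≡⟨ cong (λ ds → 1 ∷ replicate n 0 ++ p ∷ ds) (digits-repdigit q>0 q<b n) ⟩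
    1 ∷ replicate n 0 ++ p ∷ replicate n q          ∎
    where
    N≡ : N n ≡ 1 + lead n * b ^ n * b
    N≡ = trans (N-value n) (+-comm _ 1)
    N-positive : 0 < N n
    N-positive = subst (0 <_) (sym N≡) (s≤s z≤n)
    lead-digits : digitsLE b (lead n) ≡ p ∷ digitsLE b (q * R n)
    lead-digits = digits-cons (+-comm (q * R n * b) p) p<b (lead-positive n)

  digitSum-N : ∀ n → digitSum b (N n) ≡ suc n * q
  digitSum-N n = begin
    sum (digitsLE b (N n))                                  ≡⟨ cong sum (N-digits n) ⟩
    1 + sum (replicate n 0 ++ p ∷ replicate n q)            ≡⟨ cong (1 +_) (sum-++ (replicate n 0) (p ∷ replicate n q)) ⟩
    1 + (sum (replicate n 0) + (p + sum (replicate n q)))   ≡⟨ cong (1 +_) (cong₂ _+_ (sum-replicate n 0) (cong (p +_) (sum-replicate n q))) ⟩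
    1 + (n * 0 + (p + n * q))                               ≡⟨ regroup n c ⟩
    suc n * q                                               ∎
    where
    regroup : ∀ n c → 1 + (n * 0 + (suc c + n * suc (suc c))) ≡ suc n * suc (suc c)
    regroup = solve-∀

  digitSum-root : ∀ n → digitSum b (root n) ≡ suc n * q
  digitSum-root n = digitSum-repdigit q>0 q<b (suc n)

  root-palindrome : ∀ n → rev b (root n) ≡ root n
  root-palindrome n = repdigit-palindrome q>0 q<b (suc n)

-- With m = n + 1 = 2^(k-1): m ∣ R m for odd b, say R m = M·m; then
-- M·s_b(N_k) = M·m·q = r, and s_b(r) = m·q ∣ q·R m = r.
theorem27 : (b k : ℕ) → .{{_ : NonZero b}} → 3 ≤ b → b % 2 ≡ 1 → 2 ≤ k →
    IsMRH b (Nk b k)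
    × (Σ ℕ λ r → (Nk b k ≡ r * r)
        × (digitSum b r ≡ digitSum b (Nk b k))
        × (b % 4 ≡ 3 → IsNiven b r))
theorem27 (suc zero) k (s≤s ()) b-odd _
theorem27 (suc (suc (suc c))) k _ b-odd _ =
  palindrome-square-MRH b M-positive M·s≡root (root-palindrome n) (N-square n)
  , root n , N-square n , trans (digitSum-root n) (sym (digitSum-N n)) , λ _ → niven
  where
  open Square c
  open Repunit b using (repunit-positive)
  open OddBase {b} b-odd using (power-of-two-divides-repunit)
  n : ℕ
  n = 2 ^ (k ∸ 1) ∸ 1
  m∣R : suc n ∣ repunit b (suc n)
  m∣R = subst (λ m → m ∣ repunit b m) (sym (m+[n∸m]≡n (m^n>0 2 (k ∸ 1))))
          (power-of-two-divides-repunit (k ∸ 1))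
  M : ℕ
  M = quotient m∣R
  M-positive : 0 < M
  M-positive = >-nonZero⁻¹ M {{quotient≢0 m∣R {{>-nonZero (repunit-positive n)}}}}
  regroup : ∀ M m q → M * (m * q) ≡ q * (M * m)
  regroup = solve-∀
  M·s≡root : M * digitSum b (N n) ≡ root n
  M·s≡root = begin
    M * digitSum b (N n)  ≡⟨ cong (M *_) (digitSum-N n) ⟩
    M * (suc n * q)       ≡⟨ regroup M (suc n) q ⟩
    q * (M * suc n)       ≡⟨ cong (q *_) (sym (m∣n⇒n≡quotient*m m∣R)) ⟩
    root n                ∎
  niven : digitSum b (root n) ∣ root n
  niven = subst (_∣ root n) (trans (*-comm q (suc n)) (sym (digitSum-root n))) (*-monoʳ-∣ q m∣R)
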